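{- In the setting described in the context, assume $m_1\geq 1$. Then $J_{1,1}\subseteq J_1$.
   Context: Fix $r\geq 1$. For a graph $G$, $\mathrm{Con}_r(G)$ is the hypergraph on $V(G)$ whose edges are the subsets $S\subseteq V(G)$ with $|S|=r+1$ and $G[S]$ connected; a vertex cover of a hypergraph is a set of vertices meeting every edge, and a minimal vertex cover is one minimal under inclusion. Let $CG$ be a caterpillar graph: a tree with a path $\alpha_1-\alpha_2-\cdots-\alpha_l$ (the $\alpha_i$ being its internal vertices, $\alpha_i$ adjacent to $\alpha_{i-1},\alpha_{i+1}$) such that every other vertex is a leaf adjacent to exactly one $\alpha_i$. Fix $1\le t\le l$. For $i\neq t$ the leaves adjacent to $\alpha_i$ are $\beta_{i,1},\dots,\beta_{i,m_i}$ ($m_i\geq 0$), and the leaves adjacent to $\alpha_t$ are $\beta_{t,1},\dots,\beta_{t,m_t},\dots,\beta_{t,m_t'}$ with $m_t\le m_t'$. Assume $r+1=t+\sum_{i=1}^t m_i$. Let $R=\mathbb{K}[x_\theta:\theta\in V(CG)]$ over a field $\mathbb K$, and for $F\subseteq V(CG)$ put $\mathbf{x}_F=\prod_{\theta\in F}x_\theta$. All vertex covers below are minimal vertex covers $\mathcal C$ of $\mathrm{Con}_r(CG)$. For $1\le i\le t$ let $A_i$ be the set of minimal vertex covers $\mathcal C$ with $\alpha_i\in\mathcal C$ and $\alpha_j,\beta_{j,1},\dots,\beta_{j,m_j}\notin\mathcal C$ for all $1\le j\le i-1$. For $1\le i\le t$ and $1\le k\le m_i$ let $B_{i,k}$ be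 the set of minimal vertex covers $\mathcal C$ with $\beta_{i,k}\in\mathcal C$ and $\alpha_u,\alpha_i,\beta_{u,v},\beta_{i,w}\notin\mathcal C$ for all $1\le u\le i-1$, $1\le v\le m_u$, $1\le w\le k-1$. Define ideals $J_i=\langle \mathbf{x}_{\mathcal C\setminus\{\alpha_i\}}:\mathcal C\in A_i\rangle$ and $J_{i,k}=\langle \mathbf{x}_{\mathcal C\setminus\{\beta_{i,k}\}}:\mathcal C\in B_{i,k}\rangle$ of $R$. -}

module Defs where

open import Level using (Level; _⊔_)
open import Data.Bool using (Bool; true; false; _∧_; not; if_then_else_)
open import Data.Nat using (ℕ; zero; suc; _+_; _≤_; _<_; _≡ᵇ_)
open import Data.Fin using (Fin; toℕ) renaming (_≟_ to _≟F_; _≤?_ to _≤?F_)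
open import Data.List using (List; []; _∷_; _++_; map; concatMap; filter; filterᵇ; length; foldr)
open import Data.Nat.ListAction using (sum)
open import Data.List.Relation.Unary.All using (All)
open import Data.Product using (Σ; _×_; _,_; ∃)
open import Relation.Binary.PropositionalEquality using (_≡_; _≢_)
open import Relation.Nullary.Decidable using (⌊_⌋)
open import Algebra.Bundles using (CommutativeRing)
open import Data.List using (allFin) public

-- Caterpillar CG with spine α_1 - ... - α_l (indices 0..l-1 here, i.e. α (i) is α_{toℕ i + 1}),
-- distinguished index t, m i leaves at α i counted by m_i, and e extra leaves at α t
-- (so m_t' = m t + e).
module Caterpillar (l : ℕ) (t : Fin l) (m : Fin l → ℕ) (e : ℕ) where

  leaves : Fin l → ℕ
  leaves i = if ⌊ i ≟F t ⌋ then m i + e else m i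

  data Vtx : Set where
    α : Fin l → Vtx
    β : (i : Fin l) → Fin (leaves i) → Vtx

  eqᵇ : Vtx → Vtx → Bool
  eqᵇ (α i) (α j) = ⌊ i ≟F j ⌋
  eqᵇ (α i) (β j k) = false
  eqᵇ (β i k) (α j) = false
  eqᵇ (β i k) (β j k') = ⌊ i ≟F j ⌋ ∧ (toℕ k ≡ᵇ toℕ k')

  allV : List Vtx
  allV = map α (allFin l) ++ concatMap (λ i → map (β i) (allFin (leaves i))) (allFin l)

  data Adj : Vtx → Vtx → Set where
    αα  : (i j : Fin l) → suc (toℕ i) ≡ toℕ j → Adj (α i) (α j)
    αα' : (i j : Fin l) → toℕ i ≡ suc (toℕ j) → Adj (α i) (α j)
    αβ  : (i : Fin l) (k : Fin (leaves i)) → Adj (α i) (β i k)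
    βα  : (i : Fin l) (k : Fin (leaves i)) → Adj (β i k) (α i)

  Internal : Vtx → Set
  Internal v = Σ Vtx λ u → Σ Vtx λ w → Adj v u × Adj v w × u ≢ w

  Subset : Set
  Subset = Vtx → Bool

  _⊆_ : Subset → Subset → Set
  S ⊆ T = ∀ v → S v ≡ true → T v ≡ true

  ∣_∣ : Subset → ℕ
  ∣ S ∣ = length (filterᵇ S allV)

  _∖｛_｝ : Subset → Vtx → Subset
  (S ∖｛ v ｝) w = S w ∧ not (eqᵇ w v)

  data PathIn (S : Subset) : Vtx → Vtx → Set where
    here : ∀ {u} → S u ≡ true → PathIn S u u
    step : ∀ {u v w} → S u ≡ true → Adj u v → PathIn S v w → PathIn S u w

  Connected : Subset → Set
  Connected S = ∀ u v → S u ≡ true → S v ≡ true → PathIn S u v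

  -- r + 1 = t + Σ_{i=1}^t m_i  (paper's indices; here t is 0-based so t_paper = toℕ t + 1)
  rPlus1 : ℕ
  rPlus1 = suc (toℕ t) + sum (map m (filter (λ i → i ≤?F t) (allFin l)))

  ConEdge : Subset → Set
  ConEdge S = (∣ S ∣ ≡ rPlus1) × Connected S

  VertexCover : Subset → Set
  VertexCover C = ∀ S → ConEdge S → ∃ λ v → S v ≡ true × C v ≡ true

  MinimalVertexCover : Subset → Set
  MinimalVertexCover C = VertexCover C × (∀ C' → C' ⊆ C → VertexCover C' → C ⊆ C')

  A : Fin l → Subset → Set
  A i C = MinimalVertexCover C × C (α i) ≡ true
        × (∀ (j : Fin l) → toℕ j < toℕ i →
             C (α j) ≡ false × (∀ (k : Fin (leaves j)) → toℕ k < m j → C (β j k) ≡ false))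

  B : (i : Fin l) → Fin (leaves i) → Subset → Set
  B i k C = MinimalVertexCover C × C (β i k) ≡ true
        × (∀ (u : Fin l) → toℕ u < toℕ i →
             C (α u) ≡ false × (∀ (v : Fin (leaves u)) → toℕ v < m u → C (β u v) ≡ false))
        × C (α i) ≡ false
        × (∀ (w : Fin (leaves i)) → toℕ w < toℕ k → C (β i w) ≡ false)

  module Ideals {c ℓ : Level} (R : CommutativeRing c ℓ) (x : Vtx → CommutativeRing.Carrier R) where
    open CommutativeRing R using (Carrier; _≈_; 0#; 1#) renaming (_+_ to _+R_; _*_ to _*R_)

    mono : Subset → Carrier
    mono F = foldr (λ v acc → x v *R acc) 1# (filterᵇ F allV)

    InIdeal : (Subset → Set) → Carrier → Set (c ⊔ ℓ)
    InIdeal Gen f = Σ (List (Carrier × Subset)) λ cs →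
        All (λ p → Gen (Data.Product.proj₂ p)) cs
      × f ≈ foldr (λ p acc → Data.Product.proj₁ p *R mono (Data.Product.proj₂ p) +R acc) 0# cs

    GenJ : Fin l → Subset → Set
    GenJ i F = Σ Subset λ C → A i C × (∀ v → F v ≡ (C ∖｛ α i ｝) v)

    GenJ' : (i : Fin l) → Fin (leaves i) → Subset → Set
    GenJ' i k F = Σ Subset λ C → B i k C × (∀ v → F v ≡ (C ∖｛ β i k ｝) v)

    J : Fin l → Carrier → Set (c ⊔ ℓ)
    J i = InIdeal (GenJ i)

    J' : (i : Fin l) → Fin (leaves i) → Carrier → Set (c ⊔ ℓ)
    J' i k = InIdeal (GenJ' i k)

-- Let C ∈ B₁,₁ be a minimal cover through the leaf β₁,₁. An edge of Con_r through β₁,₁ is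
-- connected with r + 1 ≥ 2 vertices, so it also contains α₁; hence (C ∖ {β₁,₁}) ∪ {α₁} is again
-- a cover, and pruning it yields a minimal cover C″. C″ contains α₁, for otherwise C″ ⊆ C and the
-- minimality of C would put β₁,₁ into C″. Thus C″ ∈ A₁, and x_{C″∖{α₁}} divides x_{C∖{β₁,₁}}:
-- every generator of J₁,₁ is a multiple of a generator of J₁.
-- Pruning needs "is a vertex cover" to be decidable. This holds because subsets of the finite
-- vertex set can be enumerated and connectivity can be decided by saturating reachable sets,
-- which stabilise after at most |V| + 1 steps.

module Submission where

open import Defs
open import Level using (Level; 0ℓ)
open import Algebra.Bundles using (CommutativeRing)
import Algebra.Properties.CommutativeSemigroup as CommutativeSemigroupProperties
open import Data.Bool using (Bool; true; false; _∧_; not; T; if_then_else_) renaming (_≟_ to _≟B_)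
open import Data.Bool.Properties using (∧-conicalˡ; ∧-conicalʳ; T-≡; T-∧)
open import Data.Empty using (⊥-elim)
open import Data.Fin using (Fin; zero; toℕ)
import Data.Fin as Fin
open import Data.Fin.Properties using (toℕ-injective)
open import Data.List using (List; []; _∷_; _++_; map; length; filterᵇ; foldr; allFin; concatMap)
open import Data.List.Properties using (length-filter; filter-≐)
open import Data.List.Membership.Propositional using (_∈_)
open import Data.List.Membership.Propositional.Properties
  using (∈-map⁺; ∈-map⁻; ∈-++⁺ˡ; ∈-++⁺ʳ; ∈-concatMap⁺; ∈-concatMap⁻; ∈-allFin; ∈-filter⁻)
open import Data.List.Relation.Binary.Disjoint.Propositional using (Disjoint)
open import Data.List.Relation.Unary.All using (All; []; _∷_; all?; lookup; tabulate)
import Data.List.Relation.Unary.All.Properties as All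
import Data.List.Relation.Unary.AllPairs as AllPairs
import Data.List.Relation.Unary.AllPairs.Properties as AllPairs
open import Data.List.Relation.Unary.Any as Any using (here; there; any?)
open import Data.List.Relation.Unary.Unique.Propositional using (Unique)
import Data.List.Relation.Unary.Unique.Propositional.Properties as Unique
open import Data.Nat using (ℕ; zero; suc; _≤_; z≤n; s≤s; _≤′_; ≤′-refl; ≤′-step)
open import Data.Nat.Properties
  using (≤-trans; ≤-total; ≤-reflexive; m≤n⇒m≤1+n; n≤1+n; ≤⇒≤′; <-irrefl; m≤m+n; m≤n+m; ≡⇒≡ᵇ; ≡ᵇ⇒≡)
  renaming (_≟_ to _≟ℕ_)
open import Data.Product using (Σ; _×_; _,_; ∃; proj₁; proj₂)
open import Data.Sum using (_⊎_; inj₁; inj₂) renaming (map to ⊎-map)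
open import Function using (_∘_; id)
open import Function.Bundles using (Equivalence)
open import Relation.Binary.Definitions using (DecidableEquality)
open import Relation.Binary.PropositionalEquality
  using (_≡_; _≢_; _≗_; refl; sym; trans; cong; cong₂; subst)
open import Relation.Nullary using (Dec; yes; no; ¬_; does)
open import Relation.Nullary.Decidable
  using (T?; map′; fromWitness; dec-true; dec-false; ¬?; _×-dec_; _⊎-dec_; _→-dec_)
open import Relation.Unary using (Pred; Decidable)

true≢false : true ≢ false
true≢false ()

does-true⇒ : ∀ {P : Set} (P? : Dec P) → does P? ≡ true → P
does-true⇒ (yes p) _ = p

unique-singleton-length : ∀ {A : Set} {L : List A} {v} → Unique L → (∀ {u} → u ∈ L → u ≡ v) → length L ≤ 1
unique-singleton-length {L = []} _ _ = z≤n
unique-singleton-length {L = _ ∷ []} _ _ = s≤s z≤n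
unique-singleton-length {L = _ ∷ _ ∷ _} ((a≢b ∷ _) AllPairs.∷ _) only =
  ⊥-elim (a≢b (trans (only (here refl)) (sym (only (there (here refl))))))

module FiniteSubsets {A : Set} (_≟_ : DecidableEquality A) (enum : List A) (∈-enum : ∀ a → a ∈ enum) where

  Subset : Set
  Subset = A → Bool

  _⊆_ : Subset → Subset → Set
  X ⊆ Y = ∀ u → X u ≡ true → Y u ≡ true

  ⊆-trans : ∀ {X Y Z} → X ⊆ Y → Y ⊆ Z → X ⊆ Z
  ⊆-trans X⊆Y Y⊆Z u = Y⊆Z u ∘ X⊆Y u

  count : Subset → List A → ℕ
  count S L = length (filterᵇ S L)

  count-mono : ∀ {X Y} → X ⊆ Y → ∀ L → count X L ≤ count Y L
  count-mono X⊆Y [] = z≤n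
  count-mono {X} {Y} X⊆Y (v ∷ L) with X v in Xv | Y v in Yv
  ... | true  | true  = s≤s (count-mono X⊆Y L)
  ... | true  | false with () ← trans (sym (X⊆Y v Xv)) Yv
  ... | false | true  = m≤n⇒m≤1+n (count-mono X⊆Y L)
  ... | false | false = count-mono X⊆Y L

  count-strict : ∀ {X Y} → X ⊆ Y → ∀ {L u} → u ∈ L → Y u ≡ true → X u ≡ false → suc (count X L) ≤ count Y L
  count-strict X⊆Y {v ∷ L} (here refl) Yv Xv rewrite Yv | Xv = s≤s (count-mono X⊆Y L)
  count-strict {X} {Y} X⊆Y {v ∷ L} (there u∈L) Yu Xu with X v in Xv | Y v in Yv
  ... | true  | true  = s≤s (count-strict X⊆Y u∈L Yu Xu)
  ... | true  | false with () ← trans (sym (X⊆Y v Xv)) Yv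
  ... | false | true  = m≤n⇒m≤1+n (count-strict X⊆Y u∈L Yu Xu)
  ... | false | false = count-strict X⊆Y u∈L Yu Xu

  _-_ : Subset → A → Subset
  (S - v) w = S w ∧ not (does (w ≟ v))

  remove⁺ : ∀ S {v w} → S w ≡ true → w ≢ v → (S - v) w ≡ true
  remove⁺ S {v} {w} Sw w≢v = cong₂ _∧_ Sw (cong not (dec-false (w ≟ v) w≢v))

  remove⁻ : ∀ S {v w} → (S - v) w ≡ true → S w ≡ true × w ≢ v
  remove⁻ S {v} {w} e with w ≟ v
  ... | no w≢v = ∧-conicalˡ (S w) true e , w≢v
  ... | yes _ with () ← ∧-conicalʳ (S w) false e

  ∀? : ∀ {P : Pred A 0ℓ} → Decidable P → Dec (∀ a → P a)
  ∀? P? with all? P? enum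
  ... | yes all = yes (λ a → lookup all (∈-enum a))
  ... | no ¬all = no (λ ∀P → ¬all (tabulate (λ {a} _ → ∀P a)))

  ∃? : ∀ {P : Pred A 0ℓ} → Decidable P → Dec (∃ P)
  ∃? P? with any? P? enum
  ... | yes somewhere = yes (Any.satisfied somewhere)
  ... | no ¬somewhere = no (λ (a , Pa) → ¬somewhere (Any.map (λ { refl → Pa }) (∈-enum a)))

  ⊆-or-witness : ∀ X Y → X ⊆ Y ⊎ ∃ λ u → X u ≡ true × Y u ≡ false
  ⊆-or-witness X Y with ∃? (λ u → (X u ≟B true) ×-dec (Y u ≟B false))
  ... | yes witness = inj₂ witness
  ... | no ¬witness = inj₁ X⊆Y
    where
    X⊆Y : X ⊆ Y
    X⊆Y u Xu with Y u in Yu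
    ... | true  = refl
    ... | false = ⊥-elim (¬witness (u , Xu , Yu))

  module Saturation (f : Subset → Subset) (f-mono : ∀ {X Y} → X ⊆ Y → f X ⊆ f Y)
                    (f-inflationary : ∀ X → X ⊆ f X) (X₀ : Subset) where

    iterate : ℕ → Subset
    iterate zero = X₀
    iterate (suc k) = f (iterate k)

    iterate-mono : ∀ {j k} → j ≤′ k → iterate j ⊆ iterate k
    iterate-mono ≤′-refl = λ _ → id
    iterate-mono (≤′-step j≤k) = ⊆-trans (iterate-mono j≤k) (f-inflationary _)

    closed-absorbs : ∀ {k j} → f (iterate k) ⊆ iterate k → k ≤′ j → iterate j ⊆ iterate k
    closed-absorbs closed ≤′-refl = λ _ → id
    closed-absorbs closed (≤′-step k≤j) = ⊆-trans (f-mono (closed-absorbs closed k≤j)) closed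

    closes-or-grows : ∀ k → (∃ λ k′ → k′ ≤ k × f (iterate k′) ⊆ iterate k′) ⊎ k ≤ count (iterate k) enum
    closes-or-grows zero = inj₂ z≤n
    closes-or-grows (suc k) with closes-or-grows k | ⊆-or-witness (f (iterate k)) (iterate k)
    ... | inj₁ (k′ , k′≤k , closed) | _ = inj₁ (k′ , m≤n⇒m≤1+n k′≤k , closed)
    ... | inj₂ _ | inj₁ closed = inj₁ (k , n≤1+n k , closed)
    ... | inj₂ k≤count | inj₂ (u , fu , ¬u) =
      inj₂ (≤-trans (s≤s k≤count) (count-strict (f-inflationary _) (∈-enum u) fu ¬u))

    iterate-saturates : ∀ k → iterate k ⊆ iterate (suc (length enum))
    iterate-saturates k with closes-or-grows (suc (length enum))
    ... | inj₂ too-many =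
      ⊥-elim (<-irrefl refl (≤-trans too-many (length-filter (T? ∘ iterate (suc (length enum))) enum)))
    ... | inj₁ (k′ , k′≤K , closed) = ⊆-trans (to-k′ (≤-total k k′)) (iterate-mono (≤⇒≤′ k′≤K))
      where
      to-k′ : k ≤ k′ ⊎ k′ ≤ k → iterate k ⊆ iterate k′
      to-k′ (inj₁ k≤k′) = iterate-mono (≤⇒≤′ k≤k′)
      to-k′ (inj₂ k′≤k) = closed-absorbs closed (≤⇒≤′ k′≤k)

  update : A → Bool → Subset → Subset
  update v b S u = if does (u ≟ v) then b else S u

  subsetsOn : List A → List Subset
  subsetsOn [] = (λ _ → false) ∷ []
  subsetsOn (v ∷ L) = map (update v false) (subsetsOn L) ++ map (update v true) (subsetsOn L)

  update-∈-subsetsOn : ∀ {v L S} b → S ∈ subsetsOn L → update v b S ∈ subsetsOn (v ∷ L)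
  update-∈-subsetsOn false S∈ = ∈-++⁺ˡ (∈-map⁺ _ S∈)
  update-∈-subsetsOn {v} {L} true S∈ = ∈-++⁺ʳ (map (update v false) (subsetsOn L)) (∈-map⁺ _ S∈)

  subsetsOn-complete : ∀ (L : List A) (S : Subset) →
                       Σ Subset λ S′ → S′ ∈ subsetsOn L × (∀ {u : A} → u ∈ L → S u ≡ S′ u)
  subsetsOn-complete [] S = (λ _ → false) , here refl , λ ()
  subsetsOn-complete (v ∷ L) S with subsetsOn-complete L S
  ... | S′ , S′∈ , agree = update v (S v) S′ , update-∈-subsetsOn {L = L} (S v) S′∈ , agree′
    where
    agree′ : ∀ {u : A} → u ∈ v ∷ L → S u ≡ update v (S v) S′ u
    agree′ {u} u∈ with u ≟ v
    ... | yes refl = refl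
    ... | no u≢v = agree (Any.tail u≢v u∈)

  ∀Subset? : ∀ {P : Subset → Set} → (∀ {S S′} → S ≗ S′ → P S → P S′) →
             (∀ S → Dec (P S)) → Dec (∀ S → P S)
  ∀Subset? {P} resp P? with all? P? (subsetsOn enum)
  ... | no ¬all = no (λ ∀P → ¬all (tabulate (λ {S} _ → ∀P S)))
  ... | yes all = yes ∀P
    where
    ∀P : ∀ S → P S
    ∀P S with subsetsOn-complete enum S
    ... | S′ , S′∈ , agree = resp (λ u → sym (agree (∈-enum u))) (lookup all S′∈)

  module Minimal (P : Subset → Set) (P? : ∀ S → Dec (P S)) (P-upward : ∀ {X Y} → X ⊆ Y → P X → P Y) where

    IsMinimal : Subset → Set
    IsMinimal Z = P Z × (∀ Z′ → Z′ ⊆ Z → P Z′ → Z ⊆ Z′)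

    IrredundantOn : List A → Subset → Set
    IrredundantOn L Z = ∀ {v} → v ∈ L → Z v ≡ true → ¬ P (Z - v)

    Pruned : List A → Subset → Set
    Pruned L Y = Σ Subset λ Z → Z ⊆ Y × P Z × IrredundantOn L Z

    prune : ∀ L Y → P Y → Pruned L Y
    prune [] Y PY = Y , (λ _ → id) , PY , λ ()
    prune (v ∷ L) Y PY with P? (Y - v)
    ... | yes P[Y-v] = drop-v (prune L (Y - v) P[Y-v])
      where
      drop-v : Pruned L (Y - v) → Pruned (v ∷ L) Y
      drop-v (Z , Z⊆Y-v , PZ , irr) = Z , ⊆-trans Z⊆Y-v (λ _ → proj₁ ∘ remove⁻ Y) , PZ , irr′
        where
        irr′ : IrredundantOn (v ∷ L) Z
        irr′ (here refl) Zv = ⊥-elim (proj₂ (remove⁻ Y (Z⊆Y-v _ Zv)) refl)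
        irr′ (there u∈L) = irr u∈L
    ... | no ¬P[Y-v] = keep-v (prune L Y PY)
      where
      keep-v : Pruned L Y → Pruned (v ∷ L) Y
      keep-v (Z , Z⊆Y , PZ , irr) = Z , Z⊆Y , PZ , irr′
        where
        Z-v⊆Y-v : (Z - v) ⊆ (Y - v)
        Z-v⊆Y-v u e = remove⁺ Y (Z⊆Y u (proj₁ (remove⁻ Z e))) (proj₂ (remove⁻ Z e))
        irr′ : IrredundantOn (v ∷ L) Z
        irr′ (here refl) _ = ¬P[Y-v] ∘ P-upward Z-v⊆Y-v
        irr′ (there u∈L) = irr u∈L

    irredundant⇒minimal : ∀ {Z} → P Z → IrredundantOn enum Z → IsMinimal Z
    irredundant⇒minimal {Z} PZ irr = PZ , minimal
      where
      minimal : ∀ Z′ → Z′ ⊆ Z → P Z′ → Z ⊆ Z′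
      minimal Z′ Z′⊆Z PZ′ u Zu with Z′ u in Z′u
      ... | true = refl
      ... | false = ⊥-elim (irr (∈-enum u) Zu (P-upward Z′⊆Z-u PZ′))
        where
        Z′⊆Z-u : Z′ ⊆ (Z - u)
        Z′⊆Z-u w Z′w = remove⁺ Z (Z′⊆Z w Z′w) (λ { refl → true≢false (trans (sym Z′w) Z′u) })

    minimal-below : ∀ Y → P Y → Σ Subset λ Z → Z ⊆ Y × IsMinimal Z
    minimal-below Y PY with prune enum Y PY
    ... | Z , Z⊆Y , PZ , irr = Z , Z⊆Y , irredundant⇒minimal PZ irr

module CaterpillarFacts (n : ℕ) (t : Fin (suc n)) (m : Fin (suc n) → ℕ) (e : ℕ) where
  open Caterpillar (suc n) t m e

  eqᵇ⇒≡ : ∀ u v → T (eqᵇ u v) → u ≡ v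
  eqᵇ⇒≡ (α i) (α j) eq with i Fin.≟ j
  ... | yes refl = refl
  ... | no _ = ⊥-elim eq
  eqᵇ⇒≡ (β i k) (β j k′) eq with i Fin.≟ j
  ... | yes refl = cong (β i) (toℕ-injective (≡ᵇ⇒≡ (toℕ k) (toℕ k′) eq))
  ... | no _ = ⊥-elim eq

  eqᵇ-refl : ∀ v → T (eqᵇ v v)
  eqᵇ-refl (α i) = fromWitness {a? = i Fin.≟ i} refl
  eqᵇ-refl (β i k) = Equivalence.from T-∧ (fromWitness {a? = i Fin.≟ i} refl , ≡⇒≡ᵇ (toℕ k) (toℕ k) refl)

  -- Built from eqᵇ so that  does (u ≟ᵛ v)  reduces to  eqᵇ u v: the removal S - v of
  -- FiniteSubsets is then definitionally S ∖｛ v ｝.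
  _≟ᵛ_ : DecidableEquality Vtx
  u ≟ᵛ v = map′ (eqᵇ⇒≡ u v) (λ { refl → eqᵇ-refl u }) (T? (eqᵇ u v))

  leavesOf : Fin (suc n) → List Vtx
  leavesOf i = map (β i) (allFin (leaves i))

  ∈allV : ∀ v → v ∈ allV
  ∈allV (α i) = ∈-++⁺ˡ (∈-map⁺ α (∈-allFin i))
  ∈allV (β i k) = ∈-++⁺ʳ (map α (allFin (suc n)))
    (∈-concatMap⁺ leavesOf (Any.map (λ { refl → ∈-map⁺ (β i) (∈-allFin k) }) (∈-allFin i)))

  open FiniteSubsets _≟ᵛ_ allV ∈allV hiding (Subset; _⊆_)

  leavesOf-disjoint : ∀ {i j} → i ≢ j → Disjoint (leavesOf i) (leavesOf j)
  leavesOf-disjoint {i} {j} i≢j (p , q) with ∈-map⁻ (β i) p | ∈-map⁻ (β j) q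
  ... | _ , _ , refl | _ , _ , refl = i≢j refl

  spine-leaves-disjoint : Disjoint (map α (allFin (suc n))) (concatMap leavesOf (allFin (suc n)))
  spine-leaves-disjoint (p , q) with ∈-map⁻ α p | Any.satisfied (∈-concatMap⁻ leavesOf {xs = allFin (suc n)} q)
  ... | _ , _ , refl | j , r with ∈-map⁻ (β j) r
  ... | _ , _ , ()

  allV-unique : Unique allV
  allV-unique = Unique.++⁺
    (Unique.map⁺ (λ { refl → refl }) (Unique.allFin⁺ (suc n)))
    (Unique.concat⁺
      (All.map⁺ (All.tabulate⁺ (λ i → Unique.map⁺ (λ { refl → refl }) (Unique.allFin⁺ (leaves i)))))
      (AllPairs.map⁺ (AllPairs.map leavesOf-disjoint (Unique.allFin⁺ (suc n)))))
    spine-leaves-disjoint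

  ∣∣≤1 : ∀ {S v} → (∀ u → S u ≡ true → u ≡ v) → ∣ S ∣ ≤ 1
  ∣∣≤1 {S} only = unique-singleton-length (Unique.filter⁺ (T? ∘ S) allV-unique)
    (λ {u} u∈ → only u (Equivalence.to T-≡ (proj₂ (∈-filter⁻ (T? ∘ S) u∈))))

  ∣∣-cong : ∀ {S S′} → S ≗ S′ → ∣ S ∣ ≡ ∣ S′ ∣
  ∣∣-cong {S} {S′} S≗S′ =
    cong length (filter-≐ (T? ∘ S) (T? ∘ S′) ((λ {u} → subst T (S≗S′ u)) , (λ {u} → subst T (sym (S≗S′ u)))) allV)

  Adj? : ∀ u v → Dec (Adj u v)
  Adj? (α i) (α j) with suc (toℕ i) ≟ℕ toℕ j | toℕ i ≟ℕ suc (toℕ j)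
  ... | yes up | _ = yes (αα i j up)
  ... | no _ | yes down = yes (αα' i j down)
  ... | no ¬up | no ¬down = no λ { (αα _ _ up) → ¬up up ; (αα' _ _ down) → ¬down down }
  Adj? (α i) (β j k) with i Fin.≟ j
  ... | yes refl = yes (αβ i k)
  ... | no i≢j = no λ { (αβ _ _) → i≢j refl }
  Adj? (β i k) (α j) with i Fin.≟ j
  ... | yes refl = yes (βα i k)
  ... | no i≢j = no λ { (βα _ _) → i≢j refl }
  Adj? (β _ _) (β _ _) = no λ ()

  pathIn-head : ∀ {S u v} → PathIn S u v → S u ≡ true
  pathIn-head (here Su) = Su
  pathIn-head (step Su _ _) = Su

  pathIn-cong : ∀ {S S′ u v} → S ≗ S′ → PathIn S u v → PathIn S′ u v
  pathIn-cong S≗S′ (here Su) = here (trans (sym (S≗S′ _)) Su)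
  pathIn-cong S≗S′ (step Su adj p) = step (trans (sym (S≗S′ _)) Su) adj (pathIn-cong S≗S′ p)

  module Reachability (S : Subset) (w : Vtx) where

    Starts : Vtx → Set
    Starts u = S u ≡ true × u ≡ w

    starts? : ∀ u → Dec (Starts u)
    starts? u = (S u ≟B true) ×-dec (u ≟ᵛ w)

    Extends : Subset → Vtx → Set
    Extends X u = X u ≡ true ⊎ (S u ≡ true × ∃ λ v → X v ≡ true × Adj u v)

    extends? : ∀ X u → Dec (Extends X u)
    extends? X u = (X u ≟B true) ⊎-dec ((S u ≟B true) ×-dec ∃? (λ v → (X v ≟B true) ×-dec Adj? u v))

    extend : Subset → Subset
    extend X u = does (extends? X u)

    extend-mono : ∀ {X Y} → X ⊆ Y → extend X ⊆ extend Y
    extend-mono {X} {Y} X⊆Y u ext = dec-true (extends? Y u)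
      (⊎-map (X⊆Y u) (λ (Su , v , Xv , adj) → Su , v , X⊆Y v Xv , adj) (does-true⇒ (extends? X u) ext))

    extend-inflationary : ∀ X → X ⊆ extend X
    extend-inflationary X u Xu = dec-true (extends? X u) (inj₁ Xu)

    open Saturation extend extend-mono extend-inflationary (does ∘ starts?) public

    iterate⇒pathIn : ∀ k u → iterate k u ≡ true → PathIn S u w
    iterate⇒pathIn zero u start with does-true⇒ (starts? u) start
    ... | Su , refl = here Su
    iterate⇒pathIn (suc k) u ext with does-true⇒ (extends? (iterate k) u) ext
    ... | inj₁ reached = iterate⇒pathIn k u reached
    ... | inj₂ (Su , v , reached , adj) = step Su adj (iterate⇒pathIn k v reached)

    pathIn⇒iterate : ∀ {u} → PathIn S u w → ∃ λ k → iterate k u ≡ true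
    pathIn⇒iterate {u} (here Su) = zero , dec-true (starts? u) (Su , refl)
    pathIn⇒iterate {u} (step {v = v} Su adj p) with pathIn⇒iterate p
    ... | k , reached = suc k , dec-true (extends? (iterate k) u) (inj₂ (Su , v , reached , adj))

  -- Case analysis through an explicit equation rather than `with`: abstracting over the
  -- saturated set makes Agda unfold the whole iteration.
  PathIn? : ∀ S u w → Dec (PathIn S u w)
  PathIn? S u w = decide (iterate (suc (length allV)) u) refl
    where
    open Reachability S w
    decide : ∀ b → iterate (suc (length allV)) u ≡ b → Dec (PathIn S u w)
    decide true reached = yes (iterate⇒pathIn (suc (length allV)) u reached)
    decide false unreached = no λ p → let k , reached = pathIn⇒iterate p in
      true≢false (trans (sym (iterate-saturates k u reached)) unreached)

  Connected? : ∀ S → Dec (Connected S)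
  Connected? S = ∀? λ u → ∀? λ v → (S u ≟B true) →-dec ((S v ≟B true) →-dec PathIn? S u v)

  ConEdge? : ∀ S → Dec (ConEdge S)
  ConEdge? S = (∣ S ∣ ≟ℕ rPlus1) ×-dec Connected? S

  ConEdge-resp : ∀ {S S′} → S ≗ S′ → ConEdge S → ConEdge S′
  ConEdge-resp S≗S′ (size , connected) =
    trans (sym (∣∣-cong S≗S′)) size ,
    λ u v S′u S′v → pathIn-cong S≗S′ (connected u v (trans (S≗S′ u) S′u) (trans (S≗S′ v) S′v))

  VertexCover? : ∀ C → Dec (VertexCover C)
  VertexCover? C = ∀Subset? resp λ S → ConEdge? S →-dec ∃? λ v → (S v ≟B true) ×-dec (C v ≟B true)
    where
    resp : ∀ {S S′} → S ≗ S′ → (ConEdge S → ∃ λ v → S v ≡ true × C v ≡ true) →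
           ConEdge S′ → ∃ λ v → S′ v ≡ true × C v ≡ true
    resp S≗S′ covers edge with covers (ConEdge-resp (sym ∘ S≗S′) edge)
    ... | v , Sv , Cv = v , trans (sym (S≗S′ v)) Sv , Cv

  VertexCover-upward : ∀ {X Y} → X ⊆ Y → VertexCover X → VertexCover Y
  VertexCover-upward X⊆Y covers S edge with covers S edge
  ... | v , Sv , Xv = v , Sv , X⊆Y v Xv

  open Minimal VertexCover VertexCover? VertexCover-upward using (minimal-below)

  2≤rPlus1 : 1 ≤ m zero → 2 ≤ rPlus1
  2≤rPlus1 1≤m₁ = s≤s (≤-trans 1≤m₁ (≤-trans (m≤m+n (m zero) _) (m≤n+m _ (toℕ t))))

  edge∋leaf⇒edge∋stem : 2 ≤ rPlus1 → ∀ {S i k} → ConEdge S → S (β i k) ≡ true → S (α i) ≡ true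
  edge∋leaf⇒edge∋stem 2≤r {S} {i} {k} (size , connected) Sβ
    with ∃? (λ u → (S u ≟B true) ×-dec ¬? (u ≟ᵛ β i k))
  ... | yes (u , Su , u≢β) = stem (connected (β i k) u Sβ Su) u≢β
    where
    stem : ∀ {u} → PathIn S (β i k) u → u ≢ β i k → S (α i) ≡ true
    stem (here _) u≢β = ⊥-elim (u≢β refl)
    stem (step _ (βα _ _) p) _ = pathIn-head p
  ... | no ¬other = ⊥-elim (<-irrefl refl (≤-trans 2≤r (≤-trans (≤-reflexive (sym size)) (∣∣≤1 only))))
    where
    only : ∀ u → S u ≡ true → u ≡ β i k
    only u Su with u ≟ᵛ β i k
    ... | yes u≡β = u≡β
    ... | no u≢β = ⊥-elim (¬other (u , Su , u≢β))

  leaf-swap : 2 ≤ rPlus1 → ∀ {C i k} → MinimalVertexCover C → C (β i k) ≡ true →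
              Σ Subset λ C″ → MinimalVertexCover C″ × C″ (α i) ≡ true × (C″ ∖｛ α i ｝) ⊆ (C ∖｛ β i k ｝)
  leaf-swap 2≤r {C} {i} {k} (covers , minimal) Cβ = prune-swapped (minimal-below C′ C′-covers)
    where
    InC′ : Vtx → Set
    InC′ u = (C ∖｛ β i k ｝) u ≡ true ⊎ u ≡ α i

    inC′? : ∀ u → Dec (InC′ u)
    inC′? u = ((C ∖｛ β i k ｝) u ≟B true) ⊎-dec (u ≟ᵛ α i)

    C′ : Subset
    C′ u = does (inC′? u)

    C′-covers : VertexCover C′
    C′-covers S edge with covers S edge
    ... | v , Sv , Cv with v ≟ᵛ β i k
    ...   | yes refl = α i , edge∋leaf⇒edge∋stem 2≤r edge Sv , dec-true (inC′? (α i)) (inj₂ refl)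
    ...   | no v≢β = v , Sv , dec-true (inC′? v) (inj₁ (remove⁺ C Cv v≢β))

    β∉C′ : ¬ InC′ (β i k)
    β∉C′ (inj₁ C-β) = proj₂ (remove⁻ C C-β) refl
    β∉C′ (inj₂ ())

    prune-swapped : (Σ Subset λ C″ → C″ ⊆ C′ × MinimalVertexCover C″) →
                    Σ Subset λ C″ → MinimalVertexCover C″ × C″ (α i) ≡ true × (C″ ∖｛ α i ｝) ⊆ (C ∖｛ β i k ｝)
    prune-swapped (C″ , C″⊆C′ , C″-minimal) = C″ , C″-minimal , C″α , C″-α⊆C-β
      where
      inC′ : ∀ {u} → C″ u ≡ true → InC′ u
      inC′ {u} C″u = does-true⇒ (inC′? u) (C″⊆C′ u C″u)

      C″⊆C : C″ (α i) ≡ false → C″ ⊆ C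
      C″⊆C α∉C″ u C″u with inC′ C″u
      ... | inj₁ C-β = proj₁ (remove⁻ C C-β)
      ... | inj₂ refl = ⊥-elim (true≢false (trans (sym C″u) α∉C″))

      C″α : C″ (α i) ≡ true
      C″α with C″ (α i) in α∉C″
      ... | true = refl
      ... | false = ⊥-elim (β∉C′ (inC′ (minimal C″ (C″⊆C α∉C″) (proj₁ C″-minimal) (β i k) Cβ)))

      C″-α⊆C-β : (C″ ∖｛ α i ｝) ⊆ (C ∖｛ β i k ｝)
      C″-α⊆C-β u C″-α with remove⁻ C″ C″-α
      ... | C″u , u≢α with inC′ C″u
      ...   | inj₁ C-β = C-β
      ...   | inj₂ u≡α = ⊥-elim (u≢α u≡α)

  module IdealFacts {c ℓ : Level} (R : CommutativeRing c ℓ) (x : Vtx → CommutativeRing.Carrier R) where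
    open CommutativeRing R
      using (Carrier; _≈_; _+_; _*_; 0#; 1#; +-cong; *-congˡ; *-assoc; *-identityˡ; *-commutativeSemigroup)
    module R = CommutativeRing R
    open CommutativeSemigroupProperties *-commutativeSemigroup using (x∙yz≈y∙xz)
    open Ideals R x

    product : Subset → List Vtx → Carrier
    product F L = foldr (λ v acc → x v * acc) 1# (filterᵇ F L)

    product-split : ∀ {F G} → G ⊆ F → ∀ L → product F L ≈ product (λ u → F u ∧ not (G u)) L * product G L
    product-split G⊆F [] = R.sym (*-identityˡ 1#)
    product-split {F} {G} G⊆F (v ∷ L) with F v in Fv | G v in Gv
    ... | true  | true  = R.trans (*-congˡ (product-split G⊆F L)) (x∙yz≈y∙xz _ _ _)
    ... | true  | false = R.trans (*-congˡ (product-split G⊆F L)) (R.sym (*-assoc _ _ _))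
    ... | false | true with () ← trans (sym (G⊆F v Gv)) Fv
    ... | false | false = product-split G⊆F L

    combination : List (Carrier × Subset) → Carrier
    combination = foldr (λ p acc → proj₁ p * mono (proj₂ p) + acc) 0#

    recombine : ∀ {Gen Gen′ : Subset → Set} → (∀ {F} → Gen F → Σ Subset λ G → Gen′ G × G ⊆ F) →
                ∀ cs → All (Gen ∘ proj₂) cs →
                Σ (List (Carrier × Subset)) λ cs′ → All (Gen′ ∘ proj₂) cs′ × combination cs ≈ combination cs′
    recombine divisor [] [] = [] , [] , R.refl
    recombine divisor ((c , F) ∷ cs) (genF ∷ gens) with divisor genF | recombine divisor cs gens
    ... | G , genG , G⊆F | cs′ , gens′ , cs≈cs′ =
      (c * mono (λ u → F u ∧ not (G u)) , G) ∷ cs′ , genG ∷ gens′ ,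
      +-cong (R.trans (*-congˡ (product-split G⊆F allV)) (R.sym (*-assoc _ _ _))) cs≈cs′

    InIdeal-mono : ∀ {Gen Gen′ : Subset → Set} → (∀ {F} → Gen F → Σ Subset λ G → Gen′ G × G ⊆ F) →
                   ∀ {f} → InIdeal Gen f → InIdeal Gen′ f
    InIdeal-mono divisor (cs , gens , f≈) with recombine divisor cs gens
    ... | cs′ , gens′ , cs≈cs′ = cs′ , gens′ , R.trans f≈ cs≈cs′

lemma3p7 : ∀ {c ℓ : Level} (n : ℕ) (t : Fin (suc n)) (m : Fin (suc n) → ℕ) (e : ℕ)
    → (∀ i → Caterpillar.Internal (suc n) t m e (Caterpillar.α i))
    → (1≤m₁ : 1 ≤ m zero)
    → (R : CommutativeRing c ℓ) (x : Caterpillar.Vtx (suc n) t m e → CommutativeRing.Carrier R)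
    → ∀ (k₁ : Fin (Caterpillar.leaves (suc n) t m e zero))
    → toℕ k₁ ≡ 0
    → ∀ f → Caterpillar.Ideals.J' (suc n) t m e R x zero k₁ f
    → Caterpillar.Ideals.J (suc n) t m e R x zero f
lemma3p7 n t m e _ 1≤m₁ R x k₁ _ f = InIdeal-mono divisor
  where
  open Caterpillar (suc n) t m e
  open Ideals R x
  open CaterpillarFacts n t m e
  open IdealFacts R x

  divisor : ∀ {F} → GenJ' zero k₁ F → Σ Subset λ G → GenJ zero G × G ⊆ F
  divisor (C , (C-minimal , Cβ , _) , F≗C-β) =
    let C″ , C″-minimal , C″α , C″-α⊆C-β = leaf-swap (2≤rPlus1 1≤m₁) C-minimal Cβ
    in C″ ∖｛ α zero ｝ , (C″ , (C″-minimal , C″α , λ _ ()) , λ _ → refl) , λ u → trans (F≗C-β u) ∘ C″-α⊆C-β u
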